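{- For every integer $t \geq 3$ and every integer $s\ge 0$, $e_{3,t+1}(s) \leq e_{3,t}(s)$.
   Context: All graphs are finite and simple. A $(3,t)$-system is a pair $(H,\mathcal{F})$ where $H$ is a triangle-free graph and $\mathcal{F}$ is a family (without repeated elements) of subsets of $V(H)$, each of size exactly $t$, such that every $S\in\mathcal{F}$ is a maximal independent set of $H$, and any two distinct sets in $\mathcal{F}$ intersect. For $t\ge 3$ and $s\ge0$, $e_{3,t}(s)$ is the minimum number of edges $e(H)$ over all $(3,t)$-systems $(H,\mathcal{F})$ with $|\mathcal{F}|=s$. -}

module Defs where

open import Data.Nat using (ℕ; _≤_; _<?_)
open import Data.Bool using (Bool; true; false; _∧_; if_then_else_)
open import Data.Fin using (Fin; toℕ)
open import Data.Fin.Subset using (Subset; _∈_; _∉_; _∩_; Nonempty; ∣_∣)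
open import Data.List using (List; map; allFin; length)
open import Data.Nat.ListAction using (sum)
import Data.List.Membership.Propositional as LM
open import Data.List.Relation.Unary.Unique.Propositional using (Unique)
open import Data.Product using (Σ; _×_; ∃; ∃-syntax)
open import Relation.Binary.PropositionalEquality using (_≡_; _≢_)
open import Relation.Nullary using (¬_)
open import Relation.Nullary.Decidable using (⌊_⌋)

record Graph (n : ℕ) : Set where
  field
    adj   : Fin n → Fin n → Bool
    sym   : ∀ u v → adj u v ≡ adj v u
    irrefl : ∀ v → adj v v ≡ false
open Graph public

edges : ∀ {n} → Graph n → ℕ
edges {n} H = sum (map (λ u → sum (map (λ v →
  if ⌊ toℕ u <? toℕ v ⌋ ∧ adj H u v then 1 else 0) (allFin n))) (allFin n))

TriangleFree : ∀ {n} → Graph n → Set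
TriangleFree H = ∀ u v w → ¬ (adj H u v ≡ true × adj H v w ≡ true × adj H u w ≡ true)

Independent : ∀ {n} → Graph n → Subset n → Set
Independent H S = ∀ u v → u ∈ S → v ∈ S → adj H u v ≡ false

MaximalIndependent : ∀ {n} → Graph n → Subset n → Set
MaximalIndependent H S =
  Independent H S × (∀ v → v ∉ S → ∃[ u ] (u ∈ S × adj H u v ≡ true))

-- A (3,t)-system (H, F) with H on vertex set Fin n; F is a duplicate-free list
-- of subsets of V(H), so |F| = length F.
record System (t : ℕ) : Set where
  field
    n      : ℕ
    H      : Graph n
    F      : List (Subset n)
    tf     : TriangleFree H
    unique : Unique F
    size   : ∀ S → S LM.∈ F → ∣ S ∣ ≡ t
    maxind : ∀ S → S LM.∈ F → MaximalIndependent H S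
    inter  : ∀ S T → S LM.∈ F → T LM.∈ F → S ≢ T → Nonempty (S ∩ T)
open System public

famSize : ∀ {t} → System t → ℕ
famSize 𝒮 = length (F 𝒮)

sysEdges : ∀ {t} → System t → ℕ
sysEdges 𝒮 = edges (H 𝒮)

{-# OPTIONS --safe #-}
module Submission where

-- Add one isolated vertex to H and put it into every set of the family.
-- The new vertex has no neighbours, so no triangle and no edge is created,
-- each set stays independent and stays maximal (a missed old vertex is still
-- dominated by an old member), the sets grow from size t to t + 1, distinct
-- sets stay distinct, and any two of them now meet in the new vertex.
-- Nothing here uses t ≥ 3.

open import Defs hiding (sym)
open import Data.Bool using (Bool; true; false; _∧_; if_then_else_)
open import Data.Bool.Properties using (∧-zeroʳ)
open import Data.Empty using (⊥-elim)
open import Data.Fin using (Fin; zero; suc; toℕ)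
open import Data.Fin.Subset using (inside; _∈_; _∉_)
open import Data.Fin.Subset.Properties using (x∈p∩q⁺)
open import Data.List using (List; []; _∷_; map; allFin)
open import Data.List.Properties using (map-tabulate; map-cong; length-map)
import Data.List.Membership.Propositional as List
open import Data.List.Membership.Propositional.Properties using (∈-map⁻)
import Data.List.Relation.Unary.Unique.Propositional.Properties as Unique
open import Data.Nat using (ℕ; suc; _+_; _≤_; _≥_; _<?_; s<s; s<s⁻¹)
open import Data.Nat.ListAction using (sum)
open import Data.Nat.Properties using (≤-reflexive)
open import Data.Product using (∃-syntax; _×_; _,_)
open import Data.Vec using (_∷_; here; there)
open import Data.Vec.Properties using (∷-injectiveʳ)
open import Function using (_∘_; id)
open import Function.Bundles using (mk⇔)
open import Relation.Nullary using (does)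
open import Relation.Nullary.Decidable using (⌊_⌋; isYes≗does; does-⇔)
open import Relation.Binary.PropositionalEquality
  using (_≡_; refl; cong; cong₂; trans; sym; module ≡-Reasoning)

sum-map-zero : ∀ {A : Set} {f : A → ℕ} → (∀ x → f x ≡ 0) →
  (xs : List A) → sum (map f xs) ≡ 0
sum-map-zero f≡0 []       = refl
sum-map-zero f≡0 (x ∷ xs) = cong₂ _+_ (f≡0 x) (sum-map-zero f≡0 xs)

sum-allFin-suc : ∀ n (f : Fin (suc n) → ℕ) →
  sum (map f (allFin (suc n))) ≡ f zero + sum (map (f ∘ suc) (allFin n))
sum-allFin-suc n f = cong (λ xs → f zero + sum xs)
  (trans (map-tabulate suc f) (sym (map-tabulate id (f ∘ suc))))

sum-allFin-cong : ∀ {n} {f g : Fin n → ℕ} → (∀ i → f i ≡ g i) →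
  sum (map f (allFin n)) ≡ sum (map g (allFin n))
sum-allFin-cong f≡g = cong sum (map-cong f≡g (allFin _))

⌊s<?s⌋ : ∀ a b → ⌊ suc a <? suc b ⌋ ≡ ⌊ a <? b ⌋
⌊s<?s⌋ a b = begin
  ⌊ suc a <? suc b ⌋         ≡⟨ isYes≗does (suc a <? suc b) ⟩
  does (suc a <? suc b)      ≡⟨ does-⇔ (mk⇔ s<s⁻¹ s<s) (suc a <? suc b) (a <? b) ⟩
  does (a <? b)              ≡⟨ isYes≗does (a <? b) ⟨
  ⌊ a <? b ⌋                 ∎
  where open ≡-Reasoning

∈-map-elim : ∀ {A B : Set} {P : B → Set} (f : A → B) {xs : List A} →
  (∀ x → x List.∈ xs → P (f x)) → ∀ y → y List.∈ map f xs → P y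
∈-map-elim f P-f y y∈ with ∈-map⁻ f y∈
... | x , x∈ , refl = P-f x x∈

edgeIndicator : ∀ {n} → Graph n → Fin n → Fin n → ℕ
edgeIndicator H u v = if ⌊ toℕ u <? toℕ v ⌋ ∧ adj H u v then 1 else 0

module _ {n : ℕ} (G : Graph n) where

  isolatedAdj : Fin (suc n) → Fin (suc n) → Bool
  isolatedAdj zero    _       = false
  isolatedAdj (suc u) zero    = false
  isolatedAdj (suc u) (suc v) = adj G u v

  addIsolated : Graph (suc n)
  addIsolated = record { adj = isolatedAdj ; sym = symmetric ; irrefl = irreflexive }
    where
    symmetric : ∀ u v → isolatedAdj u v ≡ isolatedAdj v u
    symmetric zero    zero    = refl
    symmetric zero    (suc v) = refl
    symmetric (suc u) zero    = refl
    symmetric (suc u) (suc v) = Graph.sym G u v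

    irreflexive : ∀ v → isolatedAdj v v ≡ false
    irreflexive zero    = refl
    irreflexive (suc v) = irrefl G v

  edgeIndicator-addIsolated-zero : ∀ v → edgeIndicator addIsolated zero v ≡ 0
  edgeIndicator-addIsolated-zero v = cong (if_then 1 else 0) (∧-zeroʳ ⌊ 0 <? toℕ v ⌋)

  edgeIndicator-addIsolated-suc : ∀ u v →
    edgeIndicator addIsolated (suc u) (suc v) ≡ edgeIndicator G u v
  edgeIndicator-addIsolated-suc u v =
    cong (λ b → if b ∧ adj G u v then 1 else 0) (⌊s<?s⌋ (toℕ u) (toℕ v))

  edges-addIsolated : edges addIsolated ≡ edges G
  edges-addIsolated = begin
    edges addIsolated                            ≡⟨ sum-allFin-suc n row ⟩
    row zero + sum (map (row ∘ suc) (allFin n))  ≡⟨ cong₂ _+_ row-zero (sum-allFin-cong row-suc) ⟩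
    edges G                                      ∎
    where
    open ≡-Reasoning
    row : Fin (suc n) → ℕ
    row u = sum (map (edgeIndicator addIsolated u) (allFin (suc n)))
    row-zero : row zero ≡ 0
    row-zero = sum-map-zero edgeIndicator-addIsolated-zero (allFin (suc n))
    row-suc : ∀ u → row (suc u) ≡ sum (map (edgeIndicator G u) (allFin n))
    row-suc u = trans (sum-allFin-suc n (edgeIndicator addIsolated (suc u)))
                      (sum-allFin-cong (edgeIndicator-addIsolated-suc u))

  addIsolated-triangleFree : TriangleFree G → TriangleFree addIsolated
  addIsolated-triangleFree tf (suc u) (suc v) (suc w) uvw = tf u v w uvw
  addIsolated-triangleFree tf zero    _       _       (() , _)
  addIsolated-triangleFree tf (suc u) zero    _       (() , _)
  addIsolated-triangleFree tf (suc u) (suc v) zero    (_ , () , _)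

  addIsolated-maximalIndependent : ∀ {S} → MaximalIndependent G S →
    MaximalIndependent addIsolated (inside ∷ S)
  addIsolated-maximalIndependent {S} (independent , maximal) = independent′ , maximal′
    where
    independent′ : Independent addIsolated (inside ∷ S)
    independent′ zero    _       _         _         = refl
    independent′ (suc u) zero    _         _         = refl
    independent′ (suc u) (suc v) (there u∈) (there v∈) = independent u v u∈ v∈

    maximal′ : ∀ v → v ∉ inside ∷ S → ∃[ u ] (u ∈ inside ∷ S × isolatedAdj u v ≡ true)
    maximal′ zero    v∉ = ⊥-elim (v∉ here)
    maximal′ (suc v) v∉ with maximal v (v∉ ∘ there)
    ... | u , u∈ , uv = suc u , there u∈ , uv

addIsolatedVertex : ∀ {t} → System t → System (suc t)
addIsolatedVertex 𝒮 = record
  { n      = suc (n 𝒮)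
  ; H      = addIsolated (H 𝒮)
  ; F      = map (inside ∷_) (F 𝒮)
  ; tf     = addIsolated-triangleFree (H 𝒮) (tf 𝒮)
  ; unique = Unique.map⁺ ∷-injectiveʳ (unique 𝒮)
  ; size   = ∈-map-elim (inside ∷_) (λ S S∈ → cong suc (size 𝒮 S S∈))
  ; maxind = ∈-map-elim (inside ∷_)
               (λ S S∈ → addIsolated-maximalIndependent (H 𝒮) (maxind 𝒮 S S∈))
  ; inter  = λ S′ T′ S′∈ T′∈ _ → zero , x∈p∩q⁺ (zero∈ S′ S′∈ , zero∈ T′ T′∈)
  }
  where
  zero∈ : ∀ S′ → S′ List.∈ map (inside ∷_) (F 𝒮) → zero ∈ S′
  zero∈ = ∈-map-elim (inside ∷_) (λ _ _ → here)

theorem15 : (t s : ℕ) → t ≥ 3 → (𝒮 : System t) → famSize 𝒮 ≡ s →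
    ∃[ 𝒯 ] (famSize {suc t} 𝒯 ≡ s × sysEdges 𝒯 ≤ sysEdges 𝒮)
theorem15 t s _ 𝒮 |𝒮|≡s =
  addIsolatedVertex 𝒮 ,
  trans (length-map (inside ∷_) (F 𝒮)) |𝒮|≡s ,
  ≤-reflexive (edges-addIsolated (H 𝒮))
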